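{- Let $n\ge2$ be even, $k=\ell r$ with $\ell\ge2$, $r\ge2$, and let $f:\mathbb{F}_2^n\to\mathbb{Z}_{2^k}$ be a gbent function with dual $\widetilde f$. Let $\{c_j\}$ and $\{\widetilde c_j\}$ be the $2^\ell$-adic components of $f$ and $\widetilde f$. Then for each $u\in\mathbb{F}_2^n$ there is a unique $\alpha^*(u)\in(\mathbb{Z}_{2^\ell})^{r-1}$ with $C_{\alpha^*(u)}(u)\ne0$ (the unique nonzero partition cell), and $(\widetilde c_0(u),\ldots,\widetilde c_{r-2}(u))=\alpha^*(u)$.
   Context: $\zeta_N=e^{2\pi i/N}$; $W_f(u)=\sum_x\zeta_{2^k}^{f(x)}(-1)^{\langle u,x\rangle}$. $f$ is gbent if $|W_f(u)|=2^{n/2}$ for all $u$; its dual is the function $\widetilde f:\mathbb{F}_2^n\to\mathbb{Z}_{2^k}$ with $W_f(u)=2^{n/2}\zeta_{2^k}^{\widetilde f(u)}$ for all $u$. The $2^\ell$-adic components of $g:\mathbb{F}_2^n\to\mathbb{Z}_{2^k}$ are the unique $g_j:\mathbb{F}_2^n\to\mathbb{Z}_{2^\ell}$ (digits in $\{0,\ldots,2^\ell-1\}$) with $g=\sum_{j=0}^{r-1}2^{j\ell}g_j$. For $\alpha\in(\mathbb{Z}_{2^\ell})^{r-1}$, $P_\alpha=\{x:c_j(x)=\alpha_j,\ 0\le j\le r-2\}$ and $C_\alpha(u)=\sum_{x\in P_\alpha}\zeta_{2^\ell}^{c_{r-1}(x)}(-1)^{\langle u,x\rangle}$. -}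

module Defs where

open import Data.Nat as ℕ using (ℕ; zero; suc; _^_; _∸_; _<_; _≟_)
open import Data.Nat.Properties using (m^n≢0)
open import Data.Nat.DivMod using (_/_; _%_; _mod_)
open import Data.Integer as ℤ using (ℤ; +_; _-_)
open import Data.Fin using (Fin; toℕ)
open import Data.Bool using (Bool; true; false; _xor_; _∧_; if_then_else_)
open import Data.Vec as Vec using (Vec; []; _∷_; tabulate; zipWith)
open import Data.List as List using (List; []; _∷_; _++_; upTo)
open import Relation.Nullary.Decidable using (⌊_⌋)
open import Relation.Binary.PropositionalEquality using (_≡_)

F2 : ℕ → Set
F2 n = Vec Bool n

allVecs : (n : ℕ) → List (F2 n)
allVecs zero = [] ∷ []
allVecs (suc n) = List.map (false ∷_) (allVecs n) ++ List.map (true ∷_) (allVecs n)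

inner : ∀ {n} → F2 n → F2 n → Bool
inner u x = Vec.foldr _ _xor_ false (zipWith _∧_ u x)

sign : Bool → ℤ
sign false = + 1
sign true  = ℤ.- (+ 1)

sumℤ : List ℤ → ℤ
sumℤ = List.foldr ℤ._+_ (+ 0)

ΣF : (n : ℕ) → (F2 n → ℤ) → ℤ
ΣF n g = sumℤ (List.map g (allVecs n))

ΣR : ℕ → (ℕ → ℤ) → ℤ
ΣR N g = sumℤ (List.map g (upTo N))

[_]ℤ : Bool → ℤ
[ b ]ℤ = if b then + 1 else + 0

-- Exact arithmetic in ℤ[ζ_{2^e}] ⊂ ℂ (e ≥ 1).
-- A coefficient function a : ℕ → ℤ (only indices j < 2^e are used)
-- represents the complex number Σ_{j < 2^e} a j · ζ_{2^e}^j.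
-- Since the minimal polynomial of ζ_{2^e} is x^{2^{e-1}} + 1, this
-- number is 0 iff a j ≡ a (j + 2^{e-1}) for all j < 2^{e-1}.

CycZero : (e : ℕ) → (ℕ → ℤ) → Set
CycZero e a = ∀ j → j < 2 ^ (e ∸ 1) → a j ≡ a (j ℕ.+ 2 ^ (e ∸ 1))

CycEq : (e : ℕ) → (ℕ → ℤ) → (ℕ → ℤ) → Set
CycEq e a b = CycZero e (λ j → a j - b j)

-- coefficients of a · conj(a) = |a|² in ℤ[ζ_N], N = 2^e:
-- coefficient of ζ^m is Σ_{i,i' < N, i - i' ≡ m mod N} a i · a i'
normSqCoeff : (e : ℕ) → (ℕ → ℤ) → (ℕ → ℤ)
normSqCoeff e a m =
  ΣR (2 ^ e) λ i → ΣR (2 ^ e) λ i' →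
    [ ⌊ ((i ℕ.+ 2 ^ e) ∸ i') % (2 ^ e) ≟ m ⌋ ]ℤ ℤ.* (a i ℤ.* a i')
  where instance _ = m^n≢0 2 e

monoCoeff : ℤ → ℕ → (ℕ → ℤ)
monoCoeff c t j = if ⌊ j ≟ t ⌋ then c else + 0

-- Generalized Walsh–Hadamard transform of f : 𝔽₂ⁿ → ℤ_{2^k}
-- W_f(u) = Σ_x ζ_{2^k}^{f(x)} (-1)^{⟨u,x⟩}; coefficient of ζ^j:
Wcoeff : ∀ {n} (k : ℕ) → (F2 n → Fin (2 ^ k)) → F2 n → (ℕ → ℤ)
Wcoeff {n} k f u j = ΣF n λ x → [ ⌊ toℕ (f x) ≟ j ⌋ ]ℤ ℤ.* sign (inner u x)

IsGbent : (n k : ℕ) → (F2 n → Fin (2 ^ k)) → Set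
IsGbent n k f = ∀ u → CycEq k (normSqCoeff k (Wcoeff k f u)) (monoCoeff (+ (2 ^ n)) 0)

IsDual : (n k : ℕ) → (F2 n → Fin (2 ^ k)) → (F2 n → Fin (2 ^ k)) → Set
IsDual n k f g = ∀ u → CycEq k (Wcoeff k f u) (monoCoeff (+ (2 ^ (n / 2))) (toℕ (g u)))

digit : (ℓ j v : ℕ) → Fin (2 ^ ℓ)
digit ℓ j v = (v / 2 ^ (j ℕ.* ℓ)) mod (2 ^ ℓ)
  where instance _ = m^n≢0 2 (j ℕ.* ℓ)
                 _ = m^n≢0 2 ℓ

comp : ∀ {n} (k ℓ : ℕ) → (F2 n → Fin (2 ^ k)) → ℕ → F2 n → Fin (2 ^ ℓ)
comp k ℓ g j x = digit ℓ j (toℕ (g x))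

lowComps : ∀ {n} (k ℓ r : ℕ) → (F2 n → Fin (2 ^ k)) → F2 n → Vec (Fin (2 ^ ℓ)) (r ∸ 1)
lowComps k ℓ r g x = tabulate λ j → comp k ℓ g (toℕ j) x

_≡ᵛ?_ : ∀ {m A} → Vec (Fin A) m → Vec (Fin A) m → Bool
[] ≡ᵛ? [] = true
(a ∷ as) ≡ᵛ? (b ∷ bs) = ⌊ toℕ a ≟ toℕ b ⌋ ∧ (as ≡ᵛ? bs)

-- C_α(u) = Σ_{x ∈ P_α} ζ_{2^ℓ}^{c_{r-1}(x)} (-1)^{⟨u,x⟩} ∈ ℤ[ζ_{2^ℓ}]; coefficient of ζ_{2^ℓ}^j
Ccoeff : ∀ {n} (k ℓ r : ℕ) → (F2 n → Fin (2 ^ k)) → Vec (Fin (2 ^ ℓ)) (r ∸ 1) → F2 n → (ℕ → ℤ)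
Ccoeff {n} k ℓ r f α u j = ΣF n λ x →
  [ (lowComps k ℓ r f x ≡ᵛ? α) ∧ ⌊ toℕ (comp k ℓ f (r ∸ 1) x) ≟ j ⌋ ]ℤ ℤ.* sign (inner u x)

CNonzero : ∀ {n} (k ℓ r : ℕ) → (F2 n → Fin (2 ^ k)) → Vec (Fin (2 ^ ℓ)) (r ∸ 1) → F2 n → Set
CNonzero k ℓ r f α u = CycZero ℓ (Ccoeff k ℓ r f α u) → Data.Empty.⊥
  where import Data.Empty

-- Let N = 2^k and H = N/2. In ℤ[ζ_N] ≅ ℤ[x]/(x^H + 1) the dual equation
-- W_f(u) = 2^{n/2} ζ_N^{f̃(u)} says that, for i < H, the coefficients w of W_f(u) satisfy
-- w_i = w_{i+H} unless f̃(u) ∈ {i, i + H}, in which case they differ. The coefficient of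
-- ζ_{2^ℓ}^j in C_α(u) is w_e, where e has low 2^ℓ-adic digits α and top digit j, and
-- raising the top digit by 2^{ℓ-1} raises e by H. Hence C_α(u) = 0 exactly when α differs
-- from the low digits of f̃(u).

module Submission where

open import Defs
open import Data.Nat using (ℕ; zero; suc; _≤_; _<_; _+_; _*_; _^_; _∸_; _%_; _/_; NonZero; z≤n; s≤s; _≟_; _<?_)
open import Data.Nat.Properties
open import Data.Nat.DivMod
open import Data.Nat.Divisibility using (divides-refl)
open import Data.Fin as Fin using (Fin; toℕ)
open import Data.Fin.Properties using (toℕ-injective; toℕ<n; toℕ-fromℕ<)
open import Data.Vec using (Vec; []; _∷_; tabulate)
open import Data.Vec.Properties using (tabulate-cong; ≡-dec; ∷-injective)
open import Data.Integer as ℤ using (ℤ)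
open import Data.List.Properties using (map-cong)
open import Data.Product using (Σ-syntax; _×_; _,_; proj₁; proj₂)
open import Data.Sum as Sum using (_⊎_; inj₁; inj₂)
open import Data.Empty using (⊥-elim)
import Data.Integer.Properties as ℤ
open import Algebra.Properties.AbelianGroup ℤ.+-0-abelianGroup using (∙-cancelˡ; ∙-cancelʳ)
open import Function.Bundles using (_⇔_; mk⇔; Equivalence)
open Equivalence using (to; from)
open import Relation.Nullary using (Dec; yes; no)
open import Relation.Nullary.Decidable using (⌊_⌋)
open import Relation.Nullary.Reflects using (Reflects; ofʸ; ofⁿ; _×-reflects_; det)
open import Data.Nat.Tactic.RingSolver using (solve-∀)
open import Relation.Binary.PropositionalEquality

[m+kn]/n≡k : ∀ {m n} k .{{_ : NonZero n}} → m < n → (m + k * n) / n ≡ k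
[m+kn]/n≡k {m} {n} k m<n = begin
  (m + k * n) / n    ≡⟨ +-distrib-/-∣ʳ m (divides-refl k) ⟩
  m / n + k * n / n  ≡⟨ cong₂ _+_ (m<n⇒m/n≡0 m<n) (m*n/n≡m k n) ⟩
  k                  ∎
  where open ≡-Reasoning

[m+kn]%n≡m : ∀ {m n} k .{{_ : NonZero n}} → m < n → (m + k * n) % n ≡ m
[m+kn]%n≡m {m} {n} k m<n = trans ([m+kn]%n≡m%n m k n) (m<n⇒m%n≡m m<n)

mixed-radix-< : ∀ {a b x y} → a < b → x < y → a + x * b < y * b
mixed-radix-< {a} {b} {x} {y} a<b x<y = begin-strict
  a + x * b  <⟨ +-monoˡ-< (x * b) a<b ⟩
  suc x * b  ≤⟨ *-monoˡ-≤ b x<y ⟩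
  y * b      ∎
  where open ≤-Reasoning

mixed-radix-regroup : ∀ a x y p b → a + x * b + y * (p * b) ≡ a + (x + y * p) * b
mixed-radix-regroup = solve-∀

<-double-split : ∀ {b h} → b < h + h → Σ[ j ∈ ℕ ] (j < h × (b ≡ j ⊎ b ≡ j + h))
<-double-split {b} {h} b<2h with b <? h
... | yes b<h = b , b<h , inj₁ refl
... | no  b≮h = b ∸ h , +-cancelʳ-< h (b ∸ h) h (subst (_< h + h) b≡j+h b<2h) , inj₂ b≡j+h
  where b≡j+h = sym (m∸n+n≡m (≮⇒≥ b≮h))

Reflects-map : ∀ {A B : Set} {b} → (A → B) → (B → A) → Reflects A b → Reflects B b
Reflects-map to from (ofʸ a)  = ofʸ (to a)
Reflects-map to from (ofⁿ ¬a) = ofⁿ (λ b → ¬a (from b))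

⌊⌋-reflects : ∀ {A : Set} (a? : Dec A) → Reflects A ⌊ a? ⌋
⌊⌋-reflects (yes a) = ofʸ a
⌊⌋-reflects (no ¬a) = ofⁿ ¬a

≡ᵛ?-reflects : ∀ {m N} (α β : Vec (Fin N) m) → Reflects (α ≡ β) (α ≡ᵛ? β)
≡ᵛ?-reflects []       []       = ofʸ refl
≡ᵛ?-reflects (a ∷ as) (b ∷ bs) =
  Reflects-map (λ (a≡b , as≡bs) → cong₂ _∷_ (toℕ-injective a≡b) as≡bs)
               (λ eq → cong toℕ (proj₁ (∷-injective eq)) , proj₂ (∷-injective eq))
               (⌊⌋-reflects (toℕ a ≟ toℕ b) ×-reflects ≡ᵛ?-reflects as bs)

ΣF-cong : ∀ {n} {g h : F2 n → ℤ} → (∀ x → g x ≡ h x) → ΣF n g ≡ ΣF n h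
ΣF-cong {n} g≗h = cong sumℤ (map-cong g≗h (allVecs n))

CycEq-halves : ∀ {e a b i} → CycEq e a b → i < 2 ^ (e ∸ 1) →
               a i ≡ a (i + 2 ^ (e ∸ 1)) ⇔ b i ≡ b (i + 2 ^ (e ∸ 1))
CycEq-halves {e} {a} {b} {i} a≈b i<half = mk⇔
  (λ aᵢ≡aⱼ → ℤ.neg-injective (∙-cancelˡ (a i) _ _ (trans diff (cong (ℤ._- b j) (sym aᵢ≡aⱼ)))))
  (λ bᵢ≡bⱼ → ∙-cancelʳ (ℤ.- b i) _ _ (trans diff (cong (ℤ._-_ (a j)) (sym bᵢ≡bⱼ))))
  where
    j = i + 2 ^ (e ∸ 1)
    diff : a i ℤ.- b i ≡ a j ℤ.- b j
    diff = a≈b i i<half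

monoCoeff-at : ∀ c t → monoCoeff c t t ≡ c
monoCoeff-at c t with t ≟ t
... | yes _   = refl
... | no  t≢t = ⊥-elim (t≢t refl)

monoCoeff-off : ∀ c t {j} → j ≢ t → monoCoeff c t j ≡ ℤ.+ 0
monoCoeff-off c t {j} j≢t with j ≟ t
... | yes j≡t = ⊥-elim (j≢t j≡t)
... | no  _   = refl

monoCoeff-separates : ∀ {c t i d} → c ≢ ℤ.+ 0 → 0 < d → t ≡ i ⊎ t ≡ i + d →
                      monoCoeff c t i ≢ monoCoeff c t (i + d)
monoCoeff-separates {c} {i = i} {d} c≢0 0<d (inj₁ refl) eq =
  c≢0 (trans (sym (monoCoeff-at c i)) (trans eq (monoCoeff-off c i (>⇒≢ (m<m+n i 0<d)))))
monoCoeff-separates {c} {i = i} {d} c≢0 0<d (inj₂ refl) eq =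
  c≢0 (trans (sym (monoCoeff-at c (i + d)))
             (trans (sym eq) (monoCoeff-off c (i + d) (<⇒≢ (m<m+n i 0<d)))))

module Digits (ℓ : ℕ) where

  B : ℕ
  B = 2 ^ ℓ

  P : ℕ → ℕ
  P R = 2 ^ (R * ℓ)

  instance
    B≢0 : NonZero B
    B≢0 = m^n≢0 2 ℓ

  P≢0 : ∀ R → NonZero (P R)
  P≢0 R = m^n≢0 2 (R * ℓ)

  P-suc : ∀ R → P (suc R) ≡ P R * B
  P-suc R = trans (^-distribˡ-+-* 2 ℓ (R * ℓ)) (*-comm B (P R))

  fromDigits : ∀ {R} → Vec (Fin B) R → ℕ
  fromDigits []       = 0
  fromDigits (a ∷ as) = toℕ a + fromDigits as * B

  lowDigits : (R : ℕ) → ℕ → Vec (Fin B) R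
  lowDigits R v = tabulate λ i → digit ℓ (toℕ i) v

  toℕ-digit-zero : ∀ v → toℕ (digit ℓ 0 v) ≡ v % B
  toℕ-digit-zero v = trans (toℕ-fromℕ< _) (cong (_% B) (n/1≡n v))

  digit-suc : ∀ j v → digit ℓ (suc j) v ≡ digit ℓ j (v / B)
  digit-suc j v = cong (_mod B) (begin
    v / P (suc j)    ≡⟨ /-congʳ (trans (P-suc j) (*-comm (P j) B)) ⟩
    v / (B * P j)    ≡⟨ m/n/o≡m/[n*o] v B (P j) ⟨
    v / B / P j      ∎)
    where open ≡-Reasoning
          instance _ = P≢0 j
                   _ = P≢0 (suc j)
                   _ = m*n≢0 B (P j)

  lowDigits-suc : ∀ R v → lowDigits (suc R) v ≡ digit ℓ 0 v ∷ lowDigits R (v / B)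
  lowDigits-suc R v = cong (_ ∷_) (tabulate-cong λ i → digit-suc (toℕ i) v)

  lowDigits-cons : ∀ R (a : Fin B) y → lowDigits (suc R) (toℕ a + y * B) ≡ a ∷ lowDigits R y
  lowDigits-cons R a y = begin
    lowDigits (suc R) (toℕ a + y * B)
      ≡⟨ lowDigits-suc R _ ⟩
    digit ℓ 0 (toℕ a + y * B) ∷ lowDigits R ((toℕ a + y * B) / B)
      ≡⟨ cong₂ _∷_ digit-zero (cong (lowDigits R) ([m+kn]/n≡k y (toℕ<n a))) ⟩
    a ∷ lowDigits R y ∎
    where
      open ≡-Reasoning
      digit-zero : digit ℓ 0 (toℕ a + y * B) ≡ a
      digit-zero = toℕ-injective (trans (toℕ-digit-zero _) ([m+kn]%n≡m y (toℕ<n a)))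

  fromDigits-< : ∀ {R} (α : Vec (Fin B) R) → fromDigits α < P R
  fromDigits-< []                 = s≤s z≤n
  fromDigits-< {suc R} (a ∷ as) =
    subst (toℕ a + fromDigits as * B <_) (sym (P-suc R)) (mixed-radix-< (toℕ<n a) (fromDigits-< as))

  lowDigits-fromDigits : ∀ {R} (α : Vec (Fin B) R) j → lowDigits R (fromDigits α + j * P R) ≡ α
  lowDigits-fromDigits []               j = refl
  lowDigits-fromDigits {suc R} (a ∷ as) j = begin
    lowDigits (suc R) (toℕ a + fromDigits as * B + j * P (suc R))
      ≡⟨ cong (λ p → lowDigits (suc R) (toℕ a + fromDigits as * B + j * p)) (P-suc R) ⟩
    lowDigits (suc R) (toℕ a + fromDigits as * B + j * (P R * B))
      ≡⟨ cong (lowDigits (suc R)) (mixed-radix-regroup (toℕ a) (fromDigits as) j (P R) B) ⟩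
    lowDigits (suc R) (toℕ a + (fromDigits as + j * P R) * B)
      ≡⟨ lowDigits-cons R a _ ⟩
    a ∷ lowDigits R (fromDigits as + j * P R)
      ≡⟨ cong (a ∷_) (lowDigits-fromDigits as j) ⟩
    a ∷ as ∎
    where open ≡-Reasoning

  digits-decompose : ∀ R v → v < P (suc R) → fromDigits (lowDigits R v) + toℕ (digit ℓ R v) * P R ≡ v
  digits-decompose zero    v v<B = begin
    toℕ (digit ℓ 0 v) * 1  ≡⟨ *-identityʳ _ ⟩
    toℕ (digit ℓ 0 v)      ≡⟨ toℕ-digit-zero v ⟩
    v % B                  ≡⟨ m<n⇒m%n≡m (subst (v <_) (trans (P-suc 0) (*-identityˡ B)) v<B) ⟩
    v                      ∎
    where open ≡-Reasoning
  digits-decompose (suc R) v v< = begin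
    fromDigits (lowDigits (suc R) v) + toℕ (digit ℓ (suc R) v) * P (suc R)
      ≡⟨ cong₂ (λ ds d → fromDigits ds + toℕ d * P (suc R)) (lowDigits-suc R v) (digit-suc R v) ⟩
    toℕ (digit ℓ 0 v) + fromDigits (lowDigits R w) * B + toℕ (digit ℓ R w) * P (suc R)
      ≡⟨ cong₂ (λ d p → d + fromDigits (lowDigits R w) * B + toℕ (digit ℓ R w) * p)
               (toℕ-digit-zero v) (P-suc R) ⟩
    v % B + fromDigits (lowDigits R w) * B + toℕ (digit ℓ R w) * (P R * B)
      ≡⟨ mixed-radix-regroup (v % B) (fromDigits (lowDigits R w)) (toℕ (digit ℓ R w)) (P R) B ⟩
    v % B + (fromDigits (lowDigits R w) + toℕ (digit ℓ R w) * P R) * B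
      ≡⟨ cong (λ x → v % B + x * B) (digits-decompose R w w<) ⟩
    v % B + w * B
      ≡⟨ m≡m%n+[m/n]*n v B ⟨
    v ∎
    where
      open ≡-Reasoning
      w = v / B
      w< : w < P (suc R)
      w< = m<n*o⇒m/o<n (subst (v <_) (P-suc (suc R)) v<)

  toℕ-digit-top : ∀ {R} (α : Vec (Fin B) R) {j} → j < B → toℕ (digit ℓ R (fromDigits α + j * P R)) ≡ j
  toℕ-digit-top {R} α {j} j<B = begin
    toℕ (digit ℓ R (fromDigits α + j * P R))  ≡⟨ toℕ-fromℕ< _ ⟩
    (fromDigits α + j * P R) / P R % B        ≡⟨ cong (_% B) ([m+kn]/n≡k j (fromDigits-< α)) ⟩
    j % B                                     ≡⟨ m<n⇒m%n≡m j<B ⟩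
    j                                         ∎
    where open ≡-Reasoning
          instance _ = P≢0 R

  digits⇔fromDigits : ∀ {R v j} (α : Vec (Fin B) R) → v < P (suc R) → j < B →
                      (lowDigits R v ≡ α × toℕ (digit ℓ R v) ≡ j) ⇔ v ≡ fromDigits α + j * P R
  digits⇔fromDigits {R} {v} {j} α v< j<B = mk⇔
    (λ (low≡α , top≡j) → trans (sym (digits-decompose R v v<))
                                (cong₂ (λ ds d → fromDigits ds + d * P R) low≡α top≡j))
    (λ { refl → lowDigits-fromDigits α j , toℕ-digit-top α j<B })

  Ccoeff≡Wcoeff : ∀ {n} k R (f : F2 n → Fin (2 ^ k)) → (∀ x → toℕ (f x) < P (suc R)) →
                  ∀ α u {j} → j < B → Ccoeff k ℓ (suc R) f α u j ≡ Wcoeff k f u (fromDigits α + j * P R)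
  Ccoeff≡Wcoeff k R f f< α u {j} j<B = ΣF-cong λ x →
    cong (λ b → [ b ]ℤ ℤ.* sign (inner u x))
         (det (Reflects-map (to (digits⇔fromDigits α (f< x) j<B))
                            (from (digits⇔fromDigits α (f< x) j<B))
                            (≡ᵛ?-reflects _ α ×-reflects ⌊⌋-reflects _))
              (⌊⌋-reflects (toℕ (f x) ≟ fromDigits α + j * P R)))

module Cells {n} (L R : ℕ) (f fd : F2 n → Fin (2 ^ (suc L * suc R)))
             (isDual : IsDual n (suc L * suc R) f fd) (u : F2 n) where

  open Digits (suc L)

  k h H t : ℕ
  k = suc L * suc R
  h = 2 ^ L
  H = 2 ^ (k ∸ 1)
  t = toℕ (fd u)

  W : ℕ → ℤ
  W = Wcoeff k f u

  C : Vec (Fin B) R → ℕ → ℤ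
  C β = Ccoeff k (suc L) (suc R) f β u

  α* : Vec (Fin B) R
  α* = lowDigits R t

  exponent : Vec (Fin B) R → ℕ → ℕ
  exponent β j = fromDigits β + j * P R

  B≡h+h : B ≡ h + h
  B≡h+h = cong (h +_) (+-identityʳ h)

  H≡h*P : H ≡ h * P R
  H≡h*P = trans (cong (2 ^_) (exponent-identity L R)) (^-distribˡ-+-* 2 L (R * suc L))
    where exponent-identity : ∀ L R → R + L * suc R ≡ L + R * suc L
          exponent-identity = solve-∀

  exponent-+H : ∀ β j → exponent β j + H ≡ exponent β (j + h)
  exponent-+H β j = begin
    fromDigits β + j * P R + H          ≡⟨ cong (fromDigits β + j * P R +_) H≡h*P ⟩
    fromDigits β + j * P R + h * P R    ≡⟨ +-assoc (fromDigits β) _ _ ⟩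
    fromDigits β + (j * P R + h * P R)  ≡⟨ cong (fromDigits β +_) (*-distribʳ-+ (P R) j h) ⟨
    fromDigits β + (j + h) * P R        ∎
    where open ≡-Reasoning

  exponent-< : ∀ β {j} → j < h → exponent β j < H
  exponent-< β {j} j<h = subst (exponent β j <_) (sym H≡h*P) (mixed-radix-< (fromDigits-< β) j<h)

  values-< : ∀ (g : F2 n → Fin (2 ^ k)) x → toℕ (g x) < P (suc R)
  values-< g x = subst (λ e → toℕ (g x) < 2 ^ e) (*-comm (suc L) (suc R)) (toℕ<n (g x))

  C≡W : ∀ β {j} → j < B → C β j ≡ W (exponent β j)
  C≡W β = Ccoeff≡Wcoeff k R f (values-< f) β u

  C-vanishes⇔ : ∀ β → CycZero (suc L) (C β) ⇔ (∀ j → j < h → W (exponent β j) ≡ W (exponent β j + H))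
  C-vanishes⇔ β = mk⇔
    (λ C≡ j j<h → begin
      W (exponent β j)        ≡⟨ C≡W β (lower j<h) ⟨
      C β j                   ≡⟨ C≡ j j<h ⟩
      C β (j + h)             ≡⟨ C≡W β (upper j<h) ⟩
      W (exponent β (j + h))  ≡⟨ cong W (exponent-+H β j) ⟨
      W (exponent β j + H)    ∎)
    (λ W≡ j j<h → begin
      C β j                   ≡⟨ C≡W β (lower j<h) ⟩
      W (exponent β j)        ≡⟨ W≡ j j<h ⟩
      W (exponent β j + H)    ≡⟨ cong W (exponent-+H β j) ⟩
      W (exponent β (j + h))  ≡⟨ C≡W β (upper j<h) ⟨
      C β (j + h)             ∎)
    where
      open ≡-Reasoning
      lower : ∀ {j} → j < h → j < B
      lower {j} j<h = subst (j <_) (sym B≡h+h) (<-≤-trans j<h (m≤m+n h h))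
      upper : ∀ {j} → j < h → j + h < B
      upper {j} j<h = subst (j + h <_) (sym B≡h+h) (+-monoˡ-< h j<h)

  c : ℤ
  c = ℤ.+ (2 ^ (n / 2))

  c≢0 : c ≢ ℤ.+ 0
  c≢0 eq = n>0⇒n≢0 (m^n>0 2 (n / 2)) (ℤ.+-injective eq)

  W-halves : ∀ {i} → i < H → W i ≡ W (i + H) ⇔ monoCoeff c t i ≡ monoCoeff c t (i + H)
  W-halves = CycEq-halves {k} {W} {monoCoeff c t} (isDual u)

  C-vanishes-off-α* : ∀ β → β ≢ α* → CycZero (suc L) (C β)
  C-vanishes-off-α* β β≢α* = from (C-vanishes⇔ β) λ j j<h →
    from (W-halves (exponent-< β j<h))
         (trans (monoCoeff-off c t (exponent≢t j))
                (sym (monoCoeff-off c t (subst (_≢ t) (sym (exponent-+H β j)) (exponent≢t (j + h))))))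
    where
      exponent≢t : ∀ j → exponent β j ≢ t
      exponent≢t j e = β≢α* (trans (sym (lowDigits-fromDigits β j)) (cong (lowDigits R) e))

  top : ℕ
  top = toℕ (digit (suc L) R t)

  t≡exponent-top : t ≡ exponent α* top
  t≡exponent-top = sym (digits-decompose R t (values-< fd u))

  C-nonvanishing-at-α* : CNonzero k (suc L) (suc R) f α* u
  C-nonvanishing-at-α* C≡ =
    let j , j<h , top≡ = <-double-split (subst (top <_) B≡h+h (toℕ<n (digit (suc L) R t))) in
    monoCoeff-separates c≢0 (m^n>0 2 (k ∸ 1))
      (Sum.map (λ top≡j → trans t≡exponent-top (cong (exponent α*) top≡j))
               (λ top≡j+h → trans t≡exponent-top
                                    (trans (cong (exponent α*) top≡j+h) (sym (exponent-+H α* j))))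
               top≡)
      (to (W-halves (exponent-< α* j<h)) (to (C-vanishes⇔ α*) C≡ j j<h))

  C-nonvanishing⇒α* : ∀ β → CNonzero k (suc L) (suc R) f β u → β ≡ α*
  C-nonvanishing⇒α* β C≢0 with ≡-dec Fin._≟_ β α*
  ... | yes β≡α* = β≡α*
  ... | no  β≢α* = ⊥-elim (C≢0 (C-vanishes-off-α* β β≢α*))

proposition5p1 : (n k ℓ r : ℕ) → 2 ≤ n → n % 2 ≡ 0 → k ≡ ℓ * r → 2 ≤ ℓ → 2 ≤ r →
    (f : F2 n → Fin (2 ^ k)) → IsGbent n k f →
    (fd : F2 n → Fin (2 ^ k)) → IsDual n k f fd →
    (u : F2 n) →
    Σ[ α ∈ Vec (Fin (2 ^ ℓ)) (r ∸ 1) ]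
      (CNonzero k ℓ r f α u
       × (∀ (β : Vec (Fin (2 ^ ℓ)) (r ∸ 1)) → CNonzero k ℓ r f β u → β ≡ α)
       × lowComps k ℓ r fd u ≡ α)
proposition5p1 n _ (suc L) (suc R) _ _ refl (s≤s _) (s≤s _) f _ fd isDual u =
  α* , C-nonvanishing-at-α* , C-nonvanishing⇒α* , refl
  where open Cells L R f fd isDual u
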